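{- For every tournament $T$, $\Delta(T) \geq \min_{v \in V(T)} d^-(v)$.
   Context: A tournament is a digraph with exactly one arc between each pair of distinct vertices. $d^-(v)$ denotes the in-degree of $v$. Given an ordering $\sigma = \langle v_1,\dots,v_n\rangle$ of $V(T)$, an arc $(v_i,v_j)$ is backward if $j<i$. For a vertex $v$, $d_\sigma(v)$ is the number of backward arcs of $\sigma$ incident to $v$; $\Delta_\sigma(T)=\max_{v} d_\sigma(v)$; the degreewidth of $T$ is $\Delta(T)=\min_\sigma \Delta_\sigma(T)$ over all orderings $\sigma$ of $V(T)$. -}

module Defs where

open import Data.Nat using (ℕ; zero; suc; _⊔_; _⊓_; _+_; _≤_)
open import Data.Bool using (Bool; true; false; not; if_then_else_; _∧_)
open import Data.Fin using (Fin; zero; suc; _<?_)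
open import Data.Fin.Permutation using (Permutation′; _⟨$⟩ʳ_)
open import Data.List using (List; map; foldr; allFin)
open import Data.Nat.ListAction using (sum)
open import Data.Product using (Σ; _×_; _,_)
open import Relation.Nullary using (¬_)
open import Relation.Nullary.Decidable using (⌊_⌋)
open import Relation.Binary.PropositionalEquality using (_≡_)

record Tournament (n : ℕ) : Set where
  field
    arc    : Fin n → Fin n → Bool
    irrefl : ∀ u → arc u u ≡ false
    oneArc : ∀ u v → ¬ (u ≡ v) → arc u v ≡ not (arc v u)
open Tournament public

count : ∀ {n} → (Fin n → Bool) → ℕ
count {n} p = sum (map (λ j → if p j then 1 else 0) (allFin n))

-- maximum of a function over Fin n (0 for n = 0)
maxOver : ∀ {n} → (Fin n → ℕ) → ℕ
maxOver {n} f = foldr _⊔_ 0 (map f (allFin n))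

minOver : ∀ {m} → (Fin (suc m) → ℕ) → ℕ
minOver {zero}  f = f zero
minOver {suc m} f = f zero ⊓ minOver (λ i → f (suc i))

inDeg : ∀ {n} → Tournament n → Fin n → ℕ
inDeg T v = count (λ u → arc T u v)

-- An ordering σ = ⟨v_1,…,v_n⟩ is represented by a permutation sending each
-- vertex to its position: pos σ v = i iff v = v_i.
pos : ∀ {n} → Permutation′ n → Fin n → Fin n
pos σ v = σ ⟨$⟩ʳ v

backward : ∀ {n} → Tournament n → Permutation′ n → Fin n → Fin n → Bool
backward T σ u w = arc T u w ∧ ⌊ pos σ w <? pos σ u ⌋

dσ : ∀ {n} → Tournament n → Permutation′ n → Fin n → ℕ
dσ T σ v = count (λ w → backward T σ v w) + count (λ u → backward T σ u v)

Δσ : ∀ {n} → Tournament n → Permutation′ n → ℕ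
Δσ T σ = maxOver (dσ T σ)

-- d is the degreewidth Δ(T) = min_σ Δ_σ(T): attained by some ordering, and a
-- lower bound for Δ_σ(T) over all orderings σ.
IsDegreewidth : ∀ {n} → Tournament n → ℕ → Set
IsDegreewidth T d = Σ (Permutation′ _) (λ σ → Δσ T σ ≡ d) × (∀ σ → d ≤ Δσ T σ)

{-# OPTIONS --safe #-}
-- In any ordering σ, every arc entering the first vertex v₁ is backward, so
-- d⁻(v₁) ≤ d_σ(v₁) ≤ Δ_σ(T); and min_v d⁻(v) ≤ d⁻(v₁).
module Submission where

open import Defs
open import Data.Nat using (ℕ; zero; suc; _≤_; _⊔_; z≤n; z<s)
open import Data.Nat.Properties
  using (≤-refl; ≤-trans; m⊓n≤m; m⊓n≤n; m≤m⊔n; m≤n⊔m; m≤n+m; +-mono-≤; module ≤-Reasoning)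
open import Data.Bool using (Bool; true; false; if_then_else_)
open import Data.Fin using (Fin; zero; suc; _<_; _<?_)
open import Data.Fin.Permutation using (Permutation′; _⟨$⟩ˡ_; inverseʳ; inverseˡ)
open import Data.List using (List; _∷_; []; map; foldr; allFin)
open import Data.List.Membership.Propositional using (_∈_)
open import Data.List.Membership.Propositional.Properties using (∈-allFin)
open import Data.List.Relation.Unary.Any using (here; there)
open import Data.Nat.ListAction using (sum)
open import Data.Product using (_,_)
open import Relation.Nullary using (yes; no; contradiction)
open import Relation.Binary.PropositionalEquality
  using (_≡_; refl; sym; trans; cong; subst; _≢_)

minOver-≤ : ∀ {m} (f : Fin (suc m) → ℕ) i → minOver f ≤ f i
minOver-≤ {zero}  f zero    = ≤-refl
minOver-≤ {suc m} f zero    = m⊓n≤m _ _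
minOver-≤ {suc m} f (suc i) = ≤-trans (m⊓n≤n _ _) (minOver-≤ (λ j → f (suc j)) i)

foldr-⊔-map-≥ : ∀ {A : Set} (f : A → ℕ) {xs : List A} {x} → x ∈ xs →
                f x ≤ foldr _⊔_ 0 (map f xs)
foldr-⊔-map-≥ f (here refl) = m≤m⊔n _ _
foldr-⊔-map-≥ f (there x∈xs) = ≤-trans (foldr-⊔-map-≥ f x∈xs) (m≤n⊔m _ _)

≤-maxOver : ∀ {n} (f : Fin n → ℕ) i → f i ≤ maxOver f
≤-maxOver f i = foldr-⊔-map-≥ f (∈-allFin i)

count-mono : ∀ {n} (p q : Fin n → Bool) → (∀ x → p x ≡ true → q x ≡ true) →
             count p ≤ count q
count-mono {n} p q p⇒q = go (allFin n)
  where
  indicator : Bool → ℕ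
  indicator b = if b then 1 else 0

  indicator-mono : ∀ x → indicator (p x) ≤ indicator (q x)
  indicator-mono x with p x in px
  ... | false = z≤n
  ... | true rewrite p⇒q x px = ≤-refl

  go : ∀ xs → sum (map (λ j → indicator (p j)) xs) ≤ sum (map (λ j → indicator (q j)) xs)
  go []       = z≤n
  go (x ∷ xs) = +-mono-≤ (indicator-mono x) (go xs)

pos-injective : ∀ {n} (σ : Permutation′ n) {u v} → pos σ u ≡ pos σ v → u ≡ v
pos-injective σ eq = trans (sym (inverseˡ σ)) (trans (cong (σ ⟨$⟩ˡ_) eq) (inverseˡ σ))

arc⇒≢ : ∀ {n} (T : Tournament n) {u v} → arc T u v ≡ true → u ≢ v
arc⇒≢ T {u} uv refl with () ← trans (sym uv) (irrefl T u)

zero<nonzero : ∀ {n} (i : Fin (suc n)) → i ≢ zero → zero {n} < i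
zero<nonzero zero    i≢0 = contradiction refl i≢0
zero<nonzero (suc i) _   = z<s

arc-into-first-backward : ∀ {n} (T : Tournament (suc n)) (σ : Permutation′ (suc n)) {u v} →
                          pos σ v ≡ zero → arc T u v ≡ true → backward T σ u v ≡ true
arc-into-first-backward T σ {u} {v} v-first uv with pos σ v <? pos σ u
... | yes _ rewrite uv = refl
... | no v≮u = contradiction (subst (_< pos σ u) (sym v-first) (zero<nonzero _ u-not-first)) v≮u
  where
  u-not-first : pos σ u ≢ zero
  u-not-first pu = arc⇒≢ T uv (pos-injective σ (trans pu (sym v-first)))

inDeg-first≤dσ : ∀ {n} (T : Tournament (suc n)) (σ : Permutation′ (suc n)) {v} →
                 pos σ v ≡ zero → inDeg T v ≤ dσ T σ v
inDeg-first≤dσ T σ {v} v-first =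
  ≤-trans (count-mono (λ u → arc T u v) (λ u → backward T σ u v)
                      (λ u → arc-into-first-backward T σ {u} v-first))
          (m≤n+m _ (count (λ w → backward T σ v w)))

mainTheorem1 : ∀ (m : ℕ) (T : Tournament (suc m)) (d : ℕ) → IsDegreewidth T d → minOver (inDeg T) ≤ d
mainTheorem1 m T d ((σ , Δσ≡d) , _) = subst (_ ≤_) Δσ≡d (begin
  minOver (inDeg T)  ≤⟨ minOver-≤ (inDeg T) v₁ ⟩
  inDeg T v₁         ≤⟨ inDeg-first≤dσ T σ (inverseʳ σ) ⟩
  dσ T σ v₁          ≤⟨ ≤-maxOver (dσ T σ) v₁ ⟩
  Δσ T σ             ∎)
  where
  open ≤-Reasoning
  v₁ : Fin (suc m)
  v₁ = σ ⟨$⟩ˡ zero
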